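{- Let $\mathcal P$ be a pure $2$-dimensional simplicial poset, let $p$ be a walk with edges $e_1,\dots,e_n$ and vertices $v_1,\dots,v_{n+1}$, and let $p'$ be a walk obtained from $p$ by a finite sequence of elementary contractions. Then every edge $\gamma$ of $p'$ whose two consecutive vertices in $p'$ are the vertices at positions $i<j$ of $p$ (so $1\le i<j\le n+1$, $\gamma$ joining $v_i$ and $v_j$) can be obtained by contraction from the walk $e_i,\dots,e_{j-1}$ (with vertices $v_i,\dots,v_j$).
   Context: A simplicial poset is a poset with unique minimum $\hat0$ in which every interval $[\hat0,x]$ is isomorphic to a Boolean lattice; elements whose lower interval is the Boolean lattice on $1,2,3$ elements are vertices, edges, triangles; each edge has two distinct endpoints, each triangle three distinct vertices and three edge facets. Pure $2$-dimensional: every maximal element is a triangle. A walk is a sequence of edges $e_1,\dots,e_n$ ($n\ge 1$) with vertices $v_1,\dots,v_{n+1}$ such that $e_i$ has endpoints $v_i,v_{i+1}$. If $e_i,e_{i+1}$ are consecutive edges of a walk and there is a triangle whose three facets are $e_i,e_{i+1},\tilde e$, the elementary contraction along it replaces $e_i,e_{i+1}$ by $\tilde e$ and deletes the vertex $v_{i+1}$ from the vertex sequence. Positions are tracked: each vertex of a walk obtained from $p$ by elementary contractions is a surviving entry $v_k$ of the original vertex sequence, so the vertex sequence of such a walk is $v_{i_1},\dots,v_{i_{m+1}}$ with $1=i_1<\dots<i_{m+1}=n+1$. A walk $q$ can be obtained by contraction from a walk $r$ if $q$ results from $r$ by a finite (possibly empty) sequence of elementary contractions. -}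

module Defs where

open import Data.Nat using (ℕ; zero; suc; _≤_; _<_; _∸_)
open import Data.Product using (Σ; _×_; _,_; ∃)
open import Data.Fin.Subset using (Subset) renaming (_⊆_ to _⊆ˢ_)
open import Relation.Binary.PropositionalEquality using (_≡_; _≢_)
open import Relation.Binary.Structures using (IsPartialOrder)
open import Relation.Binary.Construct.Closure.ReflexiveTransitive using (Star)
open import Function.Bundles using (_⇔_)

-- The lower interval [0̂ , x] of a poset (C , ≤) is order-isomorphic to the
-- Boolean lattice (Subset k , ⊆) of subsets of a k-element set.
record BooleanIso {C : Set} (_≼_ : C → C → Set) (x : C) (k : ℕ) : Set where
  field
    to      : (y : C) → y ≼ x → Subset k
    from    : Subset k → C
    from≼x  : (s : Subset k) → from s ≼ x
    from∘to : (y : C) (p : y ≼ x) → from (to y p) ≡ y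
    to∘from : (s : Subset k) → to (from s) (from≼x s) ≡ s
    order   : (y z : C) (p : y ≼ x) (q : z ≼ x) → (y ≼ z) ⇔ (to y p ⊆ˢ to z q)

record SimplicialPoset : Set₁ where
  field
    Carrier        : Set
    _≼_            : Carrier → Carrier → Set
    isPartialOrder : IsPartialOrder _≡_ _≼_
    0̂              : Carrier
    0̂-min          : (x : Carrier) → 0̂ ≼ x
    boolean        : (x : Carrier) → Σ ℕ (BooleanIso _≼_ x)

module _ (𝒫 : SimplicialPoset) where
  open SimplicialPoset 𝒫

  HasRank : Carrier → ℕ → Set
  HasRank x k = BooleanIso _≼_ x k

  IsVertex IsEdge IsTriangle : Carrier → Set
  IsVertex   x = HasRank x 1
  IsEdge     x = HasRank x 2
  IsTriangle x = HasRank x 3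

  Maximal : Carrier → Set
  Maximal x = (y : Carrier) → x ≼ y → y ≡ x

  -- pure 2-dimensional: every element has rank ≤ 3 (dimension ≤ 2) and
  -- every maximal element is a triangle
  Pure2 : Set
  Pure2 = ((x : Carrier) (k : ℕ) → HasRank x k → k ≤ 3)
        × ((x : Carrier) → Maximal x → IsTriangle x)

  EdgeBetween : Carrier → Carrier → Carrier → Set
  EdgeBetween e u w =
    IsEdge e × IsVertex u × IsVertex w × u ≼ e × w ≼ e × u ≢ w

  TriangleFacets : Carrier → Carrier → Carrier → Set
  TriangleFacets e₁ e₂ ẽ = ∃ λ t →
    IsTriangle t × IsEdge e₁ × IsEdge e₂ × IsEdge ẽ
    × e₁ ≼ t × e₂ ≼ t × ẽ ≼ t
    × e₁ ≢ e₂ × e₁ ≢ ẽ × e₂ ≢ ẽ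

  -- Position-tracked walks: alternating vertex / edge sequences in which
  -- every vertex carries its position (a natural number) in the original walk.
  data TWalk : Set where
    end  : (pos : ℕ) (v : Carrier) → TWalk
    step : (pos : ℕ) (v : Carrier) (e : Carrier) (rest : TWalk) → TWalk

  headPos : TWalk → ℕ
  headPos (end i _)      = i
  headPos (step i _ _ _) = i

  data Contract₁ : TWalk → TWalk → Set where
    here  : ∀ {i u e₁ j w e₂ r ẽ} → TriangleFacets e₁ e₂ ẽ →
            Contract₁ (step i u e₁ (step j w e₂ r)) (step i u ẽ r)
    there : ∀ {i u e r r'} → Contract₁ r r' →
            Contract₁ (step i u e r) (step i u e r')

  ObtainedByContraction : TWalk → TWalk → Set
  ObtainedByContraction q r = Star Contract₁ r q

  data HasEdge : TWalk → ℕ → Carrier → ℕ → Set where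
    here  : ∀ {i u γ r} → HasEdge (step i u γ r) i γ (headPos r)
    there : ∀ {k u e r i γ j} → HasEdge r i γ j → HasEdge (step k u e r) i γ j

  mkWalk : (k len : ℕ) → (ℕ → Carrier) → (ℕ → Carrier) → TWalk
  mkWalk k zero      e v = end k (v k)
  mkWalk k (suc len) e v = step k (v k) (e k) (mkWalk (suc k) len e v)

  IsWalk : ℕ → (ℕ → Carrier) → (ℕ → Carrier) → Set
  IsWalk n e v = (k : ℕ) → k < n → EdgeBetween (e k) (v k) (v (suc k))

{-# OPTIONS --safe #-}
module Submission where

-- Invariant: in every walk contracted from the segment of p starting at
-- position a, each edge γ between positions b and c is itself a contraction
-- of the segment e_b, …, e_{c-1}.  Elementary contraction merges two adjacent
-- edges, whose segments are adjacent as well; contracting their concatenation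
-- first to the two edges and then along the triangle yields the merged edge.

open import Defs
open import Data.Nat using (ℕ; zero; suc; _+_; _≤_; _<_; _∸_)
open import Data.Nat.Properties using (+-identityʳ; +-suc; +-assoc; +-comm; m+n∸m≡n)
open import Relation.Binary.PropositionalEquality using (_≡_; refl; sym; cong; subst)
open import Relation.Binary.Construct.Closure.ReflexiveTransitive
  using (ε; _◅_; _◅◅_; gmap)

module WalkContraction (𝒫 : SimplicialPoset) where
  open SimplicialPoset 𝒫 using (Carrier)

  -- The last vertex of the left walk is dropped: it is the first of the right one.
  _++ʷ_ : TWalk 𝒫 → TWalk 𝒫 → TWalk 𝒫
  end _ _      ++ʷ q = q
  step i u x r ++ʷ q = step i u x (r ++ʷ q)

  contract₁-++ˡ : ∀ {p p'} q → Contract₁ 𝒫 p p' → Contract₁ 𝒫 (p ++ʷ q) (p' ++ʷ q)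
  contract₁-++ˡ q (here t)  = here t
  contract₁-++ˡ q (there c) = there (contract₁-++ˡ q c)

  contract₁-++ʳ : ∀ p {q q'} → Contract₁ 𝒫 q q' → Contract₁ 𝒫 (p ++ʷ q) (p ++ʷ q')
  contract₁-++ʳ (end _ _)      c = c
  contract₁-++ʳ (step i u x r) c = there (contract₁-++ʳ r c)

  contraction-++ˡ : ∀ {p p'} q → ObtainedByContraction 𝒫 p' p →
                    ObtainedByContraction 𝒫 (p' ++ʷ q) (p ++ʷ q)
  contraction-++ˡ q = gmap (_++ʷ q) (contract₁-++ˡ q)

  contraction-++ʳ : ∀ p {q q'} → ObtainedByContraction 𝒫 q' q →
                    ObtainedByContraction 𝒫 (p ++ʷ q') (p ++ʷ q)
  contraction-++ʳ p = gmap (p ++ʷ_) (contract₁-++ʳ p)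

  module _ (e v : ℕ → Carrier) where

    segment : ℕ → ℕ → TWalk 𝒫
    segment a l = mkWalk 𝒫 a l e v

    edgeWalk : ℕ → Carrier → ℕ → TWalk 𝒫
    edgeWalk a γ b = step a (v a) γ (end b (v b))

    segment-++ : ∀ a m l → segment a (m + l) ≡ segment a m ++ʷ segment (a + m) l
    segment-++ a zero    l rewrite +-identityʳ a = refl
    segment-++ a (suc m) l rewrite +-suc a m =
      cong (step a (v a) (e a)) (segment-++ (suc a) m l)

    SegmentContractsTo : ℕ → ℕ → Carrier → Set
    SegmentContractsTo a l γ = ObtainedByContraction 𝒫 (edgeWalk a γ (a + l)) (segment a l)

    segmentContractsTo-merge : ∀ {a l₁ l₂ γ₁ γ₂ γ} → TriangleFacets 𝒫 γ₁ γ₂ γ →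
      SegmentContractsTo a l₁ γ₁ → SegmentContractsTo (a + l₁) l₂ γ₂ →
      SegmentContractsTo a (l₁ + l₂) γ
    segmentContractsTo-merge {a} {l₁} {l₂} {γ₁} t s₁ s₂
      rewrite segment-++ a l₁ l₂ | sym (+-assoc a l₁ l₂) =
        contraction-++ˡ (segment (a + l₁) l₂) s₁
        ◅◅ contraction-++ʳ (edgeWalk a γ₁ (a + l₁)) s₂
        ◅◅ here t ◅ ε

    data FromSegments : ℕ → TWalk 𝒫 → Set where
      end  : ∀ a → FromSegments a (end a (v a))
      step : ∀ {a l γ r} → SegmentContractsTo a l γ → FromSegments (a + l) r →
             FromSegments a (step a (v a) γ r)

    fromSegments-headPos : ∀ {a r} → FromSegments a r → headPos 𝒫 r ≡ a
    fromSegments-headPos (end a)    = refl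
    fromSegments-headPos (step _ _) = refl

    segment-fromSegments : ∀ a l → FromSegments a (segment a l)
    segment-fromSegments a zero    = end a
    segment-fromSegments a (suc l) =
      step {l = 1} single
        (subst (λ b → FromSegments b (segment (suc a) l)) (sym (+-comm a 1))
               (segment-fromSegments (suc a) l))
      where
      single : SegmentContractsTo a 1 (e a)
      single rewrite +-comm a 1 = ε

    fromSegments-contract₁ : ∀ {a p q} → Contract₁ 𝒫 p q → FromSegments a p → FromSegments a q
    fromSegments-contract₁ (here t) (step {a} {l₁} s₁ (step {l = l₂} {r = r} s₂ f)) =
      step (segmentContractsTo-merge t s₁ s₂)
           (subst (λ b → FromSegments b r) (+-assoc a l₁ l₂) f)
    fromSegments-contract₁ (there c) (step s f) = step s (fromSegments-contract₁ c f)

    fromSegments-contraction : ∀ {a p q} → ObtainedByContraction 𝒫 q p →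
                               FromSegments a p → FromSegments a q
    fromSegments-contraction ε       f = f
    fromSegments-contraction (c ◅ cs) f = fromSegments-contraction cs (fromSegments-contract₁ c f)

    edge-fromSegments : ∀ {a p i γ j} → FromSegments a p → HasEdge 𝒫 p i γ j →
                        ObtainedByContraction 𝒫 (edgeWalk i γ j) (segment i (j ∸ i))
    edge-fromSegments (step {a} {l} s f) here
      rewrite fromSegments-headPos f | m+n∸m≡n a l = s
    edge-fromSegments (step _ f) (there h) = edge-fromSegments f h

    contraction-edge-segment : ∀ {a l p i γ j} → ObtainedByContraction 𝒫 p (segment a l) →
      HasEdge 𝒫 p i γ j → ObtainedByContraction 𝒫 (edgeWalk i γ j) (segment i (j ∸ i))
    contraction-edge-segment {a} {l} red =
      edge-fromSegments (fromSegments-contraction red (segment-fromSegments a l))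

lemma4p6 : (𝒫 : SimplicialPoset) → Pure2 𝒫 →
    (n : ℕ) → 1 ≤ n →
    (e v : ℕ → SimplicialPoset.Carrier 𝒫) → IsWalk 𝒫 n e v →
    (p' : TWalk 𝒫) → ObtainedByContraction 𝒫 p' (mkWalk 𝒫 0 n e v) →
    (i j : ℕ) (γ : SimplicialPoset.Carrier 𝒫) →
    i < j → j ≤ n → HasEdge 𝒫 p' i γ j →
    ObtainedByContraction 𝒫 (step i (v i) γ (end j (v j))) (mkWalk 𝒫 i (j ∸ i) e v)
lemma4p6 𝒫 _ n _ e v _ p' red i j γ _ _ =
  WalkContraction.contraction-edge-segment 𝒫 e v red
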